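{- Let $f,h\in\mathbb{Z}[t]$ with $h\neq 0$. Then, as $t$ ranges over $\mathbb{N}$ (or $\mathbb{Z}$), the functions $t\mapsto\lfloor f(t)/h(t)\rfloor$ and $t\mapsto\lfloor f(t)/h(t)\rceil$ are mild EQP.
   Context: $\lfloor x\rceil$ denotes the closest integer to $x$, with $\lfloor x\rceil=\lfloor x+1/2\rfloor$. A function $g:\mathbb{N}\to\mathbb{Z}$ is mild EQP if there are $N\in\mathbb{N}$ and polynomials $f_0,\dots,f_{N-1}\in\mathbb{Q}[t]$, all having the same degree and the same leading coefficient, such that for all sufficiently large $t$, $g(t)=f_i(t)$ whenever $t\equiv i\pmod N$. -}

module Defs where

open import Data.Nat using (ℕ; zero; suc; _≤_; NonZero)
open import Data.Nat.DivMod using (_mod_)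
open import Data.Fin using (Fin)
open import Data.Integer using (ℤ; +_; +[1+_]; -[1+_]) renaming (_+_ to _+ℤ_; _*_ to _*ℤ_; -_ to -ℤ_)
open import Data.Rational using (ℚ; 0ℚ; ½; floor; _/_) renaming (_+_ to _+ℚ_; _*_ to _*ℚ_)
open import Data.Rational.Properties using (_≟_)
open import Data.List using (List; []; _∷_)
open import Data.List.Relation.Unary.All using (All)
open import Data.Maybe using (Maybe; just; nothing)
open import Data.Product using (_×_; _,_; Σ; ∃)
open import Relation.Binary.PropositionalEquality using (_≡_)
open import Relation.Nullary using (¬_; yes; no)

-- Polynomials are coefficient lists, lowest degree first:
-- [c₀ , c₁ , … , cₖ] represents c₀ + c₁ t + … + cₖ tᵏ (trailing zeros allowed).
Polyℤ : Set
Polyℤ = List ℤ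

Polyℚ : Set
Polyℚ = List ℚ

evalℤ : Polyℤ → ℤ → ℤ
evalℤ []       t = + 0
evalℤ (c ∷ cs) t = c +ℤ (t *ℤ evalℤ cs t)

evalℚ : Polyℚ → ℚ → ℚ
evalℚ []       t = 0ℚ
evalℚ (c ∷ cs) t = c +ℚ (t *ℚ evalℚ cs t)

IsZeroPolyℤ : Polyℤ → Set
IsZeroPolyℤ p = All (_≡ + 0) p

degLead : Polyℚ → Maybe (ℕ × ℚ)
degLead []       = nothing
degLead (c ∷ cs) with degLead cs
... | just (d , a) = just (suc d , a)
... | nothing with c ≟ 0ℚ
...   | yes _ = nothing
...   | no  _ = just (0 , c)

toℚ : ℤ → ℚ
toℚ z = z / 1

-- the rational number a / b (with the convention a / 0 = 0, irrelevant below)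
divℚ : ℤ → ℤ → ℚ
divℚ a (+ zero)   = 0ℚ
divℚ a +[1+ n ]   = a / suc n
divℚ a -[1+ n ]   = (-ℤ a) / suc n

⌊_⌋ : ℚ → ℤ
⌊ x ⌋ = floor x

⌊_⌉ : ℚ → ℤ
⌊ x ⌉ = floor (x +ℚ ½)

-- mild EQP: period N = suc M ≥ 1, polynomials f₀ … f_{N-1} ∈ ℚ[t] with the same
-- degree and the same leading coefficient, and g(t) = f_{t mod N}(t) for all t ≥ T.
MildEQP : (ℕ → ℤ) → Set
MildEQP g =
  Σ ℕ λ M → Σ (Fin (suc M) → Polyℚ) λ f →
    ((i j : Fin (suc M)) → degLead (f i) ≡ degLead (f j)) ×
    ∃ λ T → (t : ℕ) → T ≤ t → toℚ (g t) ≡ evalℚ (f (t mod suc M)) (toℚ (+ t))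

-- Write h = H₀ + a tᵈ with a ≠ 0 and deg H₀ < d; replacing (f, h) by (−f, −h) we may take a > 0.
-- Pseudo-division gives L f = Q h + R with L = aᵏ > 0 and deg R < d, so eventually |R(t)| < h(t),
-- and R(t) is eventually of constant sign. If R ≥ 0 this gives ⌊f(t)/h(t)⌋ = ⌊Q(t)/L⌋, and if
-- R < 0 it gives ⌊(Q(t) − 1)/L⌋. Finally ⌊P(t)/L⌋ is mild EQP of period L: P(t) mod L only
-- depends on t mod L, and on each residue class it equals the polynomial (P − P(i) mod L)/L.
-- Rounding reduces to flooring via ⌊x/y⌉ = ⌊(2x + y)/(2y)⌋.
module Submission where

open import Data.Empty using (⊥-elim)
open import Data.Fin using (Fin; toℕ)
import Data.Fin.Properties as Finₚ
open import Data.Integer as ℤ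
  using (ℤ; +_; +[1+_]; -[1+_]; _+_; _*_; -_; _-_; _^_; _≤_; _<_; +≤+; +<+; -≤-; _/ℕ_; _%ℕ_)
import Data.Integer.DivMod as ℤD
import Data.Integer.Properties as ℤₚ
open import Data.Integer.Tactic.RingSolver using (solve-∀)
open import Data.List as List using ([]; _∷_)
open import Data.List.Relation.Unary.All as All using (All; []; _∷_; all?)
import Data.List.Relation.Unary.All.Properties as Allₚ
open import Data.Maybe using (just; nothing)
open import Data.Nat as ℕ using (ℕ; zero; suc; NonZero; _⊔_)
import Data.Nat.DivMod as ℕD
open import Data.Nat.GCD using (gcd)
import Data.Nat.Properties as ℕₚ
open import Data.Product using (Σ; _×_; _,_; proj₁; proj₂)
open import Data.Rational as ℚ using (ℚ; 0ℚ; ½; _/_; ↥_; ↧_; ↧ₙ_)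
import Data.Rational.Properties as ℚₚ
open import Data.Rational.Unnormalised as ℚᵘ using (mkℚᵘ; *≡*)
import Data.Rational.Unnormalised.Properties as ℚᵘₚ
open import Data.Sum using (_⊎_; inj₁; inj₂)
open import Data.Vec as Vec using (Vec; []; _∷_; _∷ʳ_)
import Data.Vec.Properties as Vecₚ
open import Relation.Binary using (tri<; tri≈; tri>)
open import Relation.Binary.PropositionalEquality
open import Relation.Nullary using (¬_; yes; no)

open import Defs

-- Euclidean division by a positive natural number

<-by-quotient : ∀ {r r' m : ℕ} {q q' : ℤ} → r ℕ.< m → q < q' → + r + q * + m < + r' + q' * + m
<-by-quotient {r} {r'} {m} {q} {q'} r<m q<q' = begin-strict
  + r + q * + m    <⟨ ℤₚ.+-monoˡ-< (q * + m) (+<+ r<m) ⟩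
  + m + q * + m    ≡⟨ sym (ℤₚ.suc-* q (+ m)) ⟩
  ℤ.suc q * + m    ≤⟨ ℤₚ.*-monoʳ-≤-nonNeg (+ m) (ℤₚ.i<j⇒suc[i]≤j q<q') ⟩
  q' * + m         ≤⟨ ℤₚ.i≤j+i (q' * + m) (+ r') ⟩
  + r' + q' * + m  ∎
  where open ℤₚ.≤-Reasoning

quotient-unique : ∀ {r r' m : ℕ} {q q' : ℤ} → r ℕ.< m → r' ℕ.< m →
                  + r + q * + m ≡ + r' + q' * + m → q ≡ q'
quotient-unique {q = q} {q'} r<m r'<m eq with ℤₚ.<-cmp q q'
... | tri< q<q' _ _ = ⊥-elim (ℤₚ.<-irrefl eq (<-by-quotient r<m q<q'))
... | tri≈ _ q≡q' _ = q≡q'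
... | tri> _ _ q>q' = ⊥-elim (ℤₚ.<-irrefl (sym eq) (<-by-quotient r'<m q>q'))

/ℕ-unique : ∀ {a q : ℤ} {r m : ℕ} .{{_ : NonZero m}} → r ℕ.< m → a ≡ + r + q * + m → a /ℕ m ≡ q
/ℕ-unique {a} {m = m} r<m a≡ =
  quotient-unique (ℤD.n%ℕd<d a m) r<m (trans (sym (ℤD.a≡a%ℕn+[a/ℕn]*n a m)) a≡)

/ℕ-cancel-factor : ∀ (i : ℤ) {n g m : ℕ} .{{_ : NonZero n}} .{{_ : NonZero m}} →
                   n ℕ.* g ≡ m → (i * + g) /ℕ m ≡ i /ℕ n
/ℕ-cancel-factor i {n} {g} {m} ng≡m = /ℕ-unique rg<m (begin
  i * + g                        ≡⟨ cong (_* + g) (ℤD.a≡a%ℕn+[a/ℕn]*n i n) ⟩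
  (+ r + q * + n) * + g          ≡⟨ distrib (+ r) q (+ n) (+ g) ⟩
  + r * + g + q * (+ n * + g)    ≡⟨ cong₂ (λ u v → u + q * v) (sym (ℤₚ.pos-* r g)) +ng≡m ⟩
  + (r ℕ.* g) + q * + m          ∎)
  where
  open ≡-Reasoning
  r = i %ℕ n
  q = i /ℕ n
  distrib : ∀ r q n g → (r + q * n) * g ≡ r * g + q * (n * g)
  distrib = solve-∀
  +ng≡m : + n * + g ≡ + m
  +ng≡m = trans (sym (ℤₚ.pos-* n g)) (cong +_ ng≡m)
  g≢0 : NonZero g
  g≢0 = ℕ.≢-nonZero λ g≡0 →
    ℕ.≢-nonZero⁻¹ m (trans (sym ng≡m) (trans (cong (n ℕ.*_) g≡0) (ℕₚ.*-zeroʳ n)))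
  rg<m : r ℕ.* g ℕ.< m
  rg<m = subst (r ℕ.* g ℕ.<_) ng≡m (ℕₚ.*-monoˡ-< g {{g≢0}} (ℤD.n%ℕd<d i n))

-- r = F − ⌊Q/L⌋ m satisfies L r = ρ m + E with ρ = Q mod L < L, hence 0 ≤ r < m.
/ℕ-nested : ∀ {F Q E : ℤ} {l m : ℕ} .{{_ : NonZero m}} →
            + suc l * F ≡ Q * + m + E → + 0 ≤ E → E < + m → F /ℕ m ≡ Q /ℕ suc l
/ℕ-nested {F} {Q} {E} {l} {m} LF≡ 0≤E E<m = /ℕ-unique ∣r∣<m F≡
  where
  L = + suc l
  q = Q /ℕ suc l
  ρ = Q %ℕ suc l
  r = F - q * + m
  expand : ∀ L F q m → L * (F - q * m) ≡ L * F - L * q * m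
  expand = solve-∀
  collect : ∀ ρ q L m E → ((ρ + q * L) * m + E) - L * q * m ≡ ρ * m + E
  collect = solve-∀
  Lr≡ : L * r ≡ + ρ * + m + E
  Lr≡ = begin
    L * r                                   ≡⟨ expand L F q (+ m) ⟩
    L * F - L * q * + m                     ≡⟨ cong (_- L * q * + m) LF≡ ⟩
    (Q * + m + E) - L * q * + m             ≡⟨ cong (λ z → (z * + m + E) - L * q * + m)
                                                    (ℤD.a≡a%ℕn+[a/ℕn]*n Q (suc l)) ⟩
    ((+ ρ + q * L) * + m + E) - L * q * + m ≡⟨ collect (+ ρ) q L (+ m) E ⟩
    + ρ * + m + E                           ∎
    where open ≡-Reasoning
  0≤r : + 0 ≤ r
  0≤r = ℤₚ.*-cancelˡ-≤-pos (+ 0) r L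
    (subst₂ _≤_ (sym (ℤₚ.*-zeroʳ L)) (sym Lr≡)
      (ℤₚ.+-mono-≤ (subst (+ 0 ≤_) (ℤₚ.pos-* ρ m) (+≤+ ℕ.z≤n)) 0≤E))
  r<m : r < + m
  r<m = ℤₚ.*-cancelˡ-<-nonNeg L (begin-strict
    L * r              ≡⟨ Lr≡ ⟩
    + ρ * + m + E      <⟨ ℤₚ.+-monoʳ-< (+ ρ * + m) E<m ⟩
    + ρ * + m + + m    ≡⟨ ℤₚ.+-comm (+ ρ * + m) (+ m) ⟩
    + m + + ρ * + m    ≡⟨ sym (ℤₚ.suc-* (+ ρ) (+ m)) ⟩
    + suc ρ * + m      ≤⟨ ℤₚ.*-monoʳ-≤-nonNeg (+ m) (+≤+ (ℤD.n%ℕd<d Q (suc l))) ⟩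
    L * + m            ∎)
    where open ℤₚ.≤-Reasoning
  +∣r∣≡r : + ℤ.∣ r ∣ ≡ r
  +∣r∣≡r = ℤₚ.0≤i⇒+∣i∣≡i 0≤r
  ∣r∣<m : ℤ.∣ r ∣ ℕ.< m
  ∣r∣<m = ℤₚ.drop‿+<+ (subst (_< + m) (sym +∣r∣≡r) r<m)
  F≡ : F ≡ + ℤ.∣ r ∣ + q * + m
  F≡ = trans (add-back F (q * + m)) (cong (_+ q * + m) (sym +∣r∣≡r))
    where
    add-back : ∀ F x → F ≡ (F - x) + x
    add-back = solve-∀

^-positive : ∀ n k → Σ ℕ λ l → +[1+ n ] ^ k ≡ +[1+ l ]
^-positive n zero    = 0 , refl
^-positive n (suc k) with ^-positive n k
... | l , eq = _ , cong (+[1+ n ] *_) eq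

≃-toℚᵘ-fromℚᵘ : ∀ r → r ℚᵘ.≃ ℚ.toℚᵘ (ℚ.fromℚᵘ r)
≃-toℚᵘ-fromℚᵘ r = ℚᵘₚ.≃-sym (ℚₚ.toℚᵘ-fromℚᵘ r)

fromℚᵘ-homo-+ : ∀ p q → ℚ.fromℚᵘ (p ℚᵘ.+ q) ≡ ℚ.fromℚᵘ p ℚ.+ ℚ.fromℚᵘ q
fromℚᵘ-homo-+ p q = ℚₚ.toℚᵘ-injective (begin
  ℚ.toℚᵘ (ℚ.fromℚᵘ (p ℚᵘ.+ q))  ≈⟨ ℚₚ.toℚᵘ-fromℚᵘ (p ℚᵘ.+ q) ⟩
  p ℚᵘ.+ q                      ≈⟨ ℚᵘₚ.+-cong (≃-toℚᵘ-fromℚᵘ p) (≃-toℚᵘ-fromℚᵘ q) ⟩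
  ℚ.toℚᵘ p′ ℚᵘ.+ ℚ.toℚᵘ q′      ≈⟨ ℚᵘₚ.≃-sym (ℚₚ.toℚᵘ-homo-+ p′ q′) ⟩
  ℚ.toℚᵘ (p′ ℚ.+ q′)            ∎)
  where
  open ℚᵘₚ.≃-Reasoning
  p′ = ℚ.fromℚᵘ p
  q′ = ℚ.fromℚᵘ q

fromℚᵘ-homo-* : ∀ p q → ℚ.fromℚᵘ (p ℚᵘ.* q) ≡ ℚ.fromℚᵘ p ℚ.* ℚ.fromℚᵘ q
fromℚᵘ-homo-* p q = ℚₚ.toℚᵘ-injective (begin
  ℚ.toℚᵘ (ℚ.fromℚᵘ (p ℚᵘ.* q))  ≈⟨ ℚₚ.toℚᵘ-fromℚᵘ (p ℚᵘ.* q) ⟩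
  p ℚᵘ.* q                      ≈⟨ ℚᵘₚ.*-cong (≃-toℚᵘ-fromℚᵘ p) (≃-toℚᵘ-fromℚᵘ q) ⟩
  ℚ.toℚᵘ p′ ℚᵘ.* ℚ.toℚᵘ q′      ≈⟨ ℚᵘₚ.≃-sym (ℚₚ.toℚᵘ-homo-* p′ q′) ⟩
  ℚ.toℚᵘ (p′ ℚ.* q′)            ∎)
  where
  open ℚᵘₚ.≃-Reasoning
  p′ = ℚ.fromℚᵘ p
  q′ = ℚ.fromℚᵘ q

-- toℚ c = c / 1, and c / suc n is definitionally ℚ.fromℚᵘ (mkℚᵘ c n).
toℚ-homo-+ : ∀ a b → toℚ (a + b) ≡ toℚ a ℚ.+ toℚ b
toℚ-homo-+ a b = trans (ℚₚ.fromℚᵘ-cong {mkℚᵘ (a + b) 0} {mkℚᵘ a 0 ℚᵘ.+ mkℚᵘ b 0}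
                                        (*≡* (identity a b)))
                       (fromℚᵘ-homo-+ (mkℚᵘ a 0) (mkℚᵘ b 0))
  where
  identity : ∀ a b → (a + b) * + 1 ≡ (a * + 1 + b * + 1) * + 1
  identity = solve-∀

toℚ-homo-* : ∀ a b → toℚ (a * b) ≡ toℚ a ℚ.* toℚ b
toℚ-homo-* a b = fromℚᵘ-homo-* (mkℚᵘ a 0) (mkℚᵘ b 0)

toℚ-*-cancel : ∀ q l → toℚ (q * + suc l) ℚ.* (+ 1 / suc l) ≡ toℚ q
toℚ-*-cancel q l = trans (sym (fromℚᵘ-homo-* (mkℚᵘ (q * + suc l) 0) (mkℚᵘ (+ 1) l)))
  (ℚₚ.fromℚᵘ-cong {mkℚᵘ (q * + suc l) 0 ℚᵘ.* mkℚᵘ (+ 1) l} {mkℚᵘ q 0} (*≡* (identity q (+ suc l))))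
  where
  identity : ∀ q L → (q * L * + 1) * + 1 ≡ q * (+ 1 * L)
  identity = solve-∀

toℚ-*-1/suc≡0 : ∀ c l → toℚ c ℚ.* (+ 1 / suc l) ≡ 0ℚ → c ≡ + 0
toℚ-*-1/suc≡0 c l eq = begin
  c                  ≡⟨ sym (identity c) ⟩
  c * + 1 * + 1      ≡⟨ ℚᵘₚ.drop-*≡* p≃0 ⟩
  + 0 * ℚᵘ.↧ p       ≡⟨ ℤₚ.*-zeroˡ (ℚᵘ.↧ p) ⟩
  + 0                ∎
  where
  open ≡-Reasoning
  p = mkℚᵘ c 0 ℚᵘ.* mkℚᵘ (+ 1) l
  p≃0 : p ℚᵘ.≃ mkℚᵘ (+ 0) 0
  p≃0 = ℚₚ.fromℚᵘ-injective (trans (fromℚᵘ-homo-* (mkℚᵘ c 0) (mkℚᵘ (+ 1) l)) eq)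
  identity : ∀ c → c * + 1 * + 1 ≡ c
  identity = solve-∀

floor≡↥/↧ : ∀ p → ℚ.floor p ≡ (↥ p) ℤ./ (↧ p)
floor≡↥/↧ (ℚ.mkℚ _ _ _) = refl

floor-/ : ∀ i n .{{_ : NonZero n}} → ℚ.floor (i / n) ≡ i /ℕ n
floor-/ i n = begin
  ℚ.floor p                                  ≡⟨ floor≡↥/↧ p ⟩
  (↥ p) ℤ./ (↧ p)                            ≡⟨ ℤD.div-pos-is-/ℕ (↥ p) (↧ₙ p) ⟩
  (↥ p) /ℕ (↧ₙ p)                            ≡⟨ sym (/ℕ-cancel-factor (↥ p) ↧ₙg≡n) ⟩
  (↥ p * + gcd ℤ.∣ i ∣ n) /ℕ n              ≡⟨ cong (_/ℕ n) (ℚₚ.↥-/ i n) ⟩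
  i /ℕ n                                     ∎
  where
  open ≡-Reasoning
  p = i / n
  ↧ₙg≡n : ↧ₙ p ℕ.* gcd ℤ.∣ i ∣ n ≡ n
  ↧ₙg≡n = ℤₚ.+-injective (trans (ℤₚ.pos-* (↧ₙ p) _) (ℚₚ.↧-/ i n))

divℚ-neg : ∀ x y → divℚ x y ≡ divℚ (- x) (- y)
divℚ-neg x (+ zero) = refl
divℚ-neg x +[1+ n ] = cong (_/ suc n) (sym (ℤₚ.neg-involutive x))
divℚ-neg x -[1+ n ] = refl

+-½ : ∀ y n → y / suc n ℚ.+ ½ ≡ (+ 2 * y + + suc n) / (2 ℕ.* suc n)
+-½ y n = trans (sym (fromℚᵘ-homo-+ (mkℚᵘ y n) (mkℚᵘ (+ 1) 1)))
  (ℚₚ.fromℚᵘ-cong {mkℚᵘ y n ℚᵘ.+ mkℚᵘ (+ 1) 1} {mkℚᵘ (+ 2 * y + + suc n) _} (*≡* (begin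
    (y * + 2 + + 1 * + suc n) * + (2 ℕ.* suc n)  ≡⟨ cong ((y * + 2 + + 1 * + suc n) *_) (ℤₚ.pos-* 2 (suc n)) ⟩
    (y * + 2 + + 1 * + suc n) * (+ 2 * + suc n)  ≡⟨ identity y (+ suc n) ⟩
    (+ 2 * y + + suc n) * (+ suc n * + 2)        ≡⟨ cong ((+ 2 * y + + suc n) *_) (sym (ℤₚ.pos-* (suc n) 2)) ⟩
    (+ 2 * y + + suc n) * + (suc n ℕ.* 2)        ∎)))
  where
  open ≡-Reasoning
  identity : ∀ y s → (y * + 2 + + 1 * s) * (+ 2 * s) ≡ (+ 2 * y + s) * (s * + 2)
  identity = solve-∀

round-as-floor : ∀ x y → ⌊ divℚ x y ⌉ ≡ ⌊ divℚ (+ 2 * x + y) (+ 2 * y) ⌋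
round-as-floor x (+ zero) = refl
round-as-floor x +[1+ n ] = cong ℚ.floor (+-½ x n)
round-as-floor x -[1+ n ] = cong ℚ.floor (trans (+-½ (- x) n) (cong (_/ (2 ℕ.* suc n)) (identity x (+ suc n))))
  where
  identity : ∀ x s → + 2 * (- x) + s ≡ - (+ 2 * x + - s)
  identity = solve-∀

⌊divℚ⌋≡/ℕ : ∀ l {F Q R H : ℤ} → + suc l * F ≡ Q * H + R → + 0 ≤ R → R < H →
            ⌊ divℚ F H ⌋ ≡ Q /ℕ suc l
⌊divℚ⌋≡/ℕ l {F} {Q} {H = +[1+ n ]} LF≡ 0≤R R<H =
  trans (floor-/ F (suc n)) (/ℕ-nested {Q = Q} {l = l} LF≡ 0≤R R<H)
⌊divℚ⌋≡/ℕ l {H = + zero}   _ 0≤R R<H = ⊥-elim (ℤₚ.<⇒≱ R<H 0≤R)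
⌊divℚ⌋≡/ℕ l {H = -[1+ n ]} _ 0≤R R<H = ⊥-elim (ℤₚ.<⇒≱ (ℤₚ.<-trans R<H ℤ.-<+) 0≤R)

⌊divℚ⌋≡[Q-1]/ℕ : ∀ l {F Q R H : ℤ} → + suc l * F ≡ Q * H + R → R < + 0 → - R < H →
                 ⌊ divℚ F H ⌋ ≡ (Q - + 1) /ℕ suc l
⌊divℚ⌋≡[Q-1]/ℕ l {F} {Q} {R} {H} LF≡ R<0 -R<H =
  ⌊divℚ⌋≡/ℕ l {Q = Q - + 1} (trans LF≡ (borrow Q H R)) 0≤H+R H+R<H
  where
  borrow : ∀ Q H R → Q * H + R ≡ (Q - + 1) * H + (H + R)
  borrow = solve-∀
  0≤H+R : + 0 ≤ H + R
  0≤H+R = ℤₚ.<⇒≤ (subst (_< H + R) (ℤₚ.+-inverseˡ R) (ℤₚ.+-monoˡ-< R -R<H))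
  H+R<H : H + R < H
  H+R<H = subst (H + R <_) (ℤₚ.+-identityʳ H) (ℤₚ.+-monoʳ-< H R<0)

scale : ℤ → Polyℤ → Polyℤ
scale k = List.map (k *_)

evalℤ-scale : ∀ k P x → evalℤ (scale k P) x ≡ k * evalℤ P x
evalℤ-scale k []      x = sym (ℤₚ.*-zeroʳ k)
evalℤ-scale k (c ∷ P) x = trans (cong (λ e → k * c + x * e) (evalℤ-scale k P x)) (identity k c x (evalℤ P x))
  where
  identity : ∀ k c x e → k * c + x * (k * e) ≡ k * (c + x * e)
  identity = solve-∀

infixl 6 _+ₚ_
_+ₚ_ : Polyℤ → Polyℤ → Polyℤ
[]      +ₚ Q       = Q
(c ∷ P) +ₚ []      = c ∷ P
(c ∷ P) +ₚ (d ∷ Q) = (c + d) ∷ (P +ₚ Q)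

evalℤ-+ₚ : ∀ P Q x → evalℤ (P +ₚ Q) x ≡ evalℤ P x + evalℤ Q x
evalℤ-+ₚ []      Q       x = sym (ℤₚ.+-identityˡ (evalℤ Q x))
evalℤ-+ₚ (c ∷ P) []      x = sym (ℤₚ.+-identityʳ (evalℤ (c ∷ P) x))
evalℤ-+ₚ (c ∷ P) (d ∷ Q) x =
  trans (cong (λ e → (c + d) + x * e) (evalℤ-+ₚ P Q x)) (identity c d x (evalℤ P x) (evalℤ Q x))
  where
  identity : ∀ c d x e e' → (c + d) + x * (e + e') ≡ (c + x * e) + (d + x * e')
  identity = solve-∀

subConst : ℤ → Polyℤ → Polyℤ
subConst v []      = - v ∷ []
subConst v (c ∷ P) = (c - v) ∷ P

evalℤ-subConst : ∀ v P x → evalℤ (subConst v P) x ≡ evalℤ P x - v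
evalℤ-subConst v []      x = identity v x
  where
  identity : ∀ v x → - v + x * + 0 ≡ + 0 - v
  identity = solve-∀
evalℤ-subConst v (c ∷ P) x = identity c v x (evalℤ P x)
  where
  identity : ∀ c v x e → (c - v) + x * e ≡ (c + x * e) - v
  identity = solve-∀

evalℤ-zeros : ∀ {P} → IsZeroPolyℤ P → ∀ x → evalℤ P x ≡ + 0
evalℤ-zeros []           x = refl
evalℤ-zeros (refl ∷ P≡0) x rewrite evalℤ-zeros P≡0 x | ℤₚ.*-zeroʳ x = refl

evalℤ-∷-zeros : ∀ c {P} → IsZeroPolyℤ P → ∀ x → evalℤ (c ∷ P) x ≡ c
evalℤ-∷-zeros c P≡0 x rewrite evalℤ-zeros P≡0 x | ℤₚ.*-zeroʳ x = ℤₚ.+-identityʳ c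

evalℤ-+-multiple : ∀ P y k L → Σ ℤ λ j → evalℤ P (y + k * L) ≡ evalℤ P y + j * L
evalℤ-+-multiple []      y k L = + 0 , sym (ℤₚ.+-identityˡ (+ 0 * L))
evalℤ-+-multiple (c ∷ P) y k L with evalℤ-+-multiple P y k L
... | j , eq = y * j + k * evalℤ P y + k * j * L ,
  trans (cong (λ e → c + (y + k * L) * e) eq) (identity c y k L (evalℤ P y) j)
  where
  identity : ∀ c y k L e j → c + (y + k * L) * (e + j * L) ≡ (c + y * e) + (y * j + k * e + k * j * L) * L
  identity = solve-∀

scale-nonzero : ∀ k .{{_ : ℤ.NonZero k}} P → ¬ IsZeroPolyℤ P → ¬ IsZeroPolyℤ (scale k P)
scale-nonzero k P P≢0 kP≡0 =
  P≢0 (All.map (λ {c} kc≡0 → ℤₚ.*-cancelˡ-≡ k c (+ 0) (trans kc≡0 (sym (ℤₚ.*-zeroʳ k))))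
               (Allₚ.map⁻ kP≡0))

evalᵥ : ∀ {d} → Vec ℤ d → ℤ → ℤ
evalᵥ v = evalℤ (Vec.toList v)

scaleᵥ : ∀ {d} → ℤ → Vec ℤ d → Vec ℤ d
scaleᵥ k = Vec.map (k *_)

evalᵥ-scale : ∀ {d} k (v : Vec ℤ d) x → evalᵥ (scaleᵥ k v) x ≡ k * evalᵥ v x
evalᵥ-scale k v x = trans (cong (λ P → evalℤ P x) (Vecₚ.toList-map (k *_) v)) (evalℤ-scale k (Vec.toList v) x)

evalᵥ-difference : ∀ {d} (u v : Vec ℤ d) x → evalᵥ (Vec.zipWith _-_ u v) x ≡ evalᵥ u x - evalᵥ v x
evalᵥ-difference []      []      x = refl
evalᵥ-difference (b ∷ u) (c ∷ v) x =
  trans (cong (λ e → (b - c) + x * e) (evalᵥ-difference u v x)) (identity b c x (evalᵥ u x) (evalᵥ v x))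
  where
  identity : ∀ b c x e e' → (b - c) + x * (e - e') ≡ (b + x * e) - (c + x * e')
  identity = solve-∀

evalᵥ-replicate-0 : ∀ d x → evalᵥ (Vec.replicate d (+ 0)) x ≡ + 0
evalᵥ-replicate-0 zero    x = refl
evalᵥ-replicate-0 (suc d) x rewrite evalᵥ-replicate-0 d x | ℤₚ.*-zeroʳ x = refl

evalᵥ-∷ʳ : ∀ {d} (v : Vec ℤ d) b x → evalᵥ (v ∷ʳ b) x ≡ evalᵥ v x + b * x ^ d
evalᵥ-∷ʳ []      b x = identity b x
  where
  identity : ∀ b x → b + x * + 0 ≡ + 0 + b * + 1
  identity = solve-∀
evalᵥ-∷ʳ {suc d} (c ∷ v) b x =
  trans (cong (λ e → c + x * e) (evalᵥ-∷ʳ v b x)) (identity c x (evalᵥ v x) b (x ^ d))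
  where
  identity : ∀ c x e b p → c + x * (e + b * p) ≡ (c + x * e) + b * (x * p)
  identity = solve-∀

evalWithLead : ∀ {d} → Vec ℤ d → ℤ → ℤ → ℤ
evalWithLead {d} H₀ a x = evalᵥ H₀ x + a * x ^ d

evalWithLead-∷ : ∀ {d} c (H₀ : Vec ℤ d) a x → evalWithLead (c ∷ H₀) a x ≡ c + x * evalWithLead H₀ a x
evalWithLead-∷ {d} c H₀ a x = identity c x (evalᵥ H₀ x) a (x ^ d)
  where
  identity : ∀ c x e a p → (c + x * e) + a * (x * p) ≡ c + x * (e + a * p)
  identity = solve-∀

evalWithLead-scale : ∀ {d} k (H₀ : Vec ℤ d) a x →
                     evalWithLead (scaleᵥ k H₀) (k * a) x ≡ k * evalWithLead H₀ a x
evalWithLead-scale {d} k H₀ a x =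
  trans (cong (_+ k * a * x ^ d) (evalᵥ-scale k H₀ x)) (identity k (evalᵥ H₀ x) a (x ^ d))
  where
  identity : ∀ k e a p → k * e + k * a * p ≡ k * (e + a * p)
  identity = solve-∀

evalWithLead-difference : ∀ {d} (H₀ R : Vec ℤ d) a x →
                         evalWithLead (Vec.zipWith _-_ H₀ R) a x ≡ evalWithLead H₀ a x - evalᵥ R x
evalWithLead-difference {d} H₀ R a x =
  trans (cong (_+ a * x ^ d) (evalᵥ-difference H₀ R x)) (identity (evalᵥ H₀ x) (evalᵥ R x) (a * x ^ d))
  where
  identity : ∀ e r p → (e - r) + p ≡ (e + p) - r
  identity = solve-∀

leadingForm : ∀ h → ¬ IsZeroPolyℤ h →
              Σ ℕ λ d → Σ (Vec ℤ d) λ H₀ → Σ ℤ λ a →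
                ¬ a ≡ + 0 × (∀ x → evalℤ h x ≡ evalWithLead H₀ a x)
leadingForm []      h≢0 = ⊥-elim (h≢0 [])
leadingForm (c ∷ h) h≢0 with all? (ℤ._≟ + 0) h
... | yes h≡0 = 0 , [] , c , (λ c≡0 → h≢0 (c≡0 ∷ h≡0)) ,
  λ x → trans (evalℤ-∷-zeros c h≡0 x) (sym (trans (ℤₚ.+-identityˡ (c * + 1)) (ℤₚ.*-identityʳ c)))
... | no h≢0′ with leadingForm h h≢0′
...   | d , H₀ , a , a≢0 , eval≡ = suc d , c ∷ H₀ , a , a≢0 ,
  λ x → trans (cong (λ e → c + x * e) (eval≡ x)) (sym (evalWithLead-∷ c H₀ a x))

-- Pseudo-division

record PseudoDivision {d} (H₀ : Vec ℤ d) (a : ℤ) (F : Polyℤ) : Set where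
  field
    exponent  : ℕ
    quotient  : Polyℤ
    remainder : Vec ℤ d
    identity  : ∀ x → a ^ exponent * evalℤ F x ≡ evalℤ quotient x * evalWithLead H₀ a x + evalᵥ remainder x

pseudoDivide : ∀ {d} (H₀ : Vec ℤ d) a F → PseudoDivision H₀ a F
pseudoDivide {d} H₀ a [] = record
  { exponent  = 0
  ; quotient  = []
  ; remainder = Vec.replicate d (+ 0)
  ; identity  = λ x → sym (trans (cong (_+_ (+ 0 * H x)) (evalᵥ-replicate-0 d x)) (zeros (H x)))
  }
  where
  H = evalWithLead H₀ a
  zeros : ∀ h → + 0 * h + + 0 ≡ + 1 * + 0
  zeros = solve-∀
pseudoDivide {d} H₀ a (c ∷ F) with pseudoDivide H₀ a F
... | record { exponent = k ; quotient = Q ; remainder = R ; identity = eq } with Vec.initLast (c * a ^ k ∷ R)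
...   | S , b , split = record
  { exponent  = suc k
  ; quotient  = b ∷ scale a Q
  ; remainder = Vec.zipWith _-_ (scaleᵥ a S) (scaleᵥ b H₀)
  ; identity  = step
  }
  where
  open ≡-Reasoning
  expand : ∀ a aᵏ c x f → a * aᵏ * (c + x * f) ≡ a * (c * aᵏ + x * (aᵏ * f))
  expand = solve-∀
  regroup : ∀ a aᵏ c x q h r → a * (c * aᵏ + x * (q * h + r)) ≡ x * (a * q) * h + a * (c * aᵏ + x * r)
  regroup = solve-∀
  -- a (S + b xᵈ) = (a S − b H₀) + b H, since a xᵈ = H − H₀.
  eliminate-top : ∀ a x q h₀ p s b →
    x * (a * q) * (h₀ + a * p) + a * (s + b * p) ≡ (b + x * (a * q)) * (h₀ + a * p) + (a * s - b * h₀)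
  eliminate-top = solve-∀
  step : ∀ x → a ^ suc k * evalℤ (c ∷ F) x
             ≡ evalℤ (b ∷ scale a Q) x * evalWithLead H₀ a x
               + evalᵥ (Vec.zipWith _-_ (scaleᵥ a S) (scaleᵥ b H₀)) x
  step x = begin
    a * a ^ k * (c + x * evalℤ F x)                 ≡⟨ expand a (a ^ k) c x (evalℤ F x) ⟩
    a * (c * a ^ k + x * (a ^ k * evalℤ F x))       ≡⟨ cong (λ e → a * (c * a ^ k + x * e)) (eq x) ⟩
    a * (c * a ^ k + x * (q * H + evalᵥ R x))       ≡⟨ regroup a (a ^ k) c x q H (evalᵥ R x) ⟩
    x * (a * q) * H + a * evalᵥ (c * a ^ k ∷ R) x   ≡⟨ cong (λ v → x * (a * q) * H + a * evalᵥ v x) split ⟩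
    x * (a * q) * H + a * evalᵥ (S ∷ʳ b) x          ≡⟨ cong (λ e → x * (a * q) * H + a * e) (evalᵥ-∷ʳ S b x) ⟩
    x * (a * q) * H + a * (evalᵥ S x + b * x ^ d)   ≡⟨ eliminate-top a x q (evalᵥ H₀ x) (x ^ d) (evalᵥ S x) b ⟩
    (b + x * (a * q)) * H + (a * evalᵥ S x - b * evalᵥ H₀ x)
      ≡⟨ cong₂ (λ u v → (b + x * u) * H + v) (sym (evalℤ-scale a Q x)) (sym remainder≡) ⟩
    evalℤ (b ∷ scale a Q) x * H + evalᵥ (Vec.zipWith _-_ (scaleᵥ a S) (scaleᵥ b H₀)) x ∎
    where
    q = evalℤ Q x
    H = evalWithLead H₀ a x
    remainder≡ : evalᵥ (Vec.zipWith _-_ (scaleᵥ a S) (scaleᵥ b H₀)) x ≡ a * evalᵥ S x - b * evalᵥ H₀ x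
    remainder≡ = trans (evalᵥ-difference (scaleᵥ a S) (scaleᵥ b H₀) x)
                       (cong₂ _-_ (evalᵥ-scale a S x) (evalᵥ-scale b H₀ x))

-- Eventual behaviour of polynomials on ℕ

Eventually : (ℕ → Set) → Set
Eventually P = Σ ℕ λ T → ∀ t → T ℕ.≤ t → P t

always : ∀ {P : ℕ → Set} → (∀ t → P t) → Eventually P
always p = 0 , λ t _ → p t

eventually-map : ∀ {P Q : ℕ → Set} → (∀ t → P t → Q t) → Eventually P → Eventually Q
eventually-map f (T , p) = T , λ t T≤t → f t (p t T≤t)

eventually-× : ∀ {P Q : ℕ → Set} → Eventually P → Eventually Q → Eventually (λ t → P t × Q t)
eventually-× (T , p) (T' , q) = T ⊔ T' , λ t T⊔T'≤t →
  p t (ℕₚ.m⊔n≤o⇒m≤o T T' T⊔T'≤t) , q t (ℕₚ.m⊔n≤o⇒n≤o T T' T⊔T'≤t)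

1≤i+suc∣i∣ : ∀ i → + 1 ≤ i + + suc ℤ.∣ i ∣
1≤i+suc∣i∣ (+ n)    = +≤+ (ℕₚ.≤-trans (ℕ.s≤s ℕ.z≤n) (ℕₚ.m≤n+m (suc n) n))
1≤i+suc∣i∣ -[1+ n ] = ℤₚ.≤-reflexive (sym (cancel (+ suc n)))
  where
  cancel : ∀ s → - s + (+ 1 + s) ≡ + 1
  cancel = solve-∀

horner-eventually-≥1 : ∀ c (q : ℕ → ℤ) → Eventually (λ t → + 1 ≤ q t) →
                       Eventually (λ t → + 1 ≤ c + + t * q t)
horner-eventually-≥1 c q (T , q≥1) = T ⊔ suc ℤ.∣ c ∣ , λ t T⊔≤t →
  bound t (ℕₚ.m⊔n≤o⇒n≤o T _ T⊔≤t) (q≥1 t (ℕₚ.m⊔n≤o⇒m≤o T _ T⊔≤t))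
  where
  open ℤₚ.≤-Reasoning
  bound : ∀ t → suc ℤ.∣ c ∣ ℕ.≤ t → + 1 ≤ q t → + 1 ≤ c + + t * q t
  bound t ∣c∣<t 1≤qt = begin
    + 1                  ≤⟨ 1≤i+suc∣i∣ c ⟩
    c + + suc ℤ.∣ c ∣    ≤⟨ ℤₚ.+-monoʳ-≤ c (+≤+ ∣c∣<t) ⟩
    c + + t              ≡⟨ cong (_+_ c) (sym (ℤₚ.*-identityʳ (+ t))) ⟩
    c + + t * + 1        ≤⟨ ℤₚ.+-monoʳ-≤ c (ℤₚ.*-monoˡ-≤-nonNeg (+ t) 1≤qt) ⟩
    c + + t * q t        ∎

horner-eventually-≤-1 : ∀ c (q : ℕ → ℤ) → Eventually (λ t → q t ≤ - + 1) →
                        Eventually (λ t → c + + t * q t ≤ - + 1)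
horner-eventually-≤-1 c q q≤-1 = eventually-map
  (λ t h → subst (_≤ - + 1) (negate-twice c (+ t) (q t)) (ℤₚ.neg-mono-≤ h))
  (horner-eventually-≥1 (- c) (λ t → - q t) (eventually-map (λ t → ℤₚ.neg-mono-≤) q≤-1))
  where
  negate-twice : ∀ c t q → - (- c + t * (- q)) ≡ c + t * q
  negate-twice = solve-∀

evalWithLead-eventually-≥1 : ∀ {d} (H₀ : Vec ℤ d) a → + 1 ≤ a →
                             Eventually (λ t → + 1 ≤ evalWithLead H₀ a (+ t))
evalWithLead-eventually-≥1 []       a 1≤a = always λ t → subst (+ 1 ≤_) (sym (lead a)) 1≤a
  where
  lead : ∀ a → + 0 + a * + 1 ≡ a
  lead = solve-∀
evalWithLead-eventually-≥1 (c ∷ H₀) a 1≤a = eventually-map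
  (λ t → subst (+ 1 ≤_) (sym (evalWithLead-∷ c H₀ a (+ t))))
  (horner-eventually-≥1 c (λ t → evalWithLead H₀ a (+ t)) (evalWithLead-eventually-≥1 H₀ a 1≤a))

evalᵥ-eventually-< : ∀ {d} (H₀ R : Vec ℤ d) a → + 1 ≤ a →
                     Eventually (λ t → evalᵥ R (+ t) < evalWithLead H₀ a (+ t))
evalᵥ-eventually-< H₀ R a 1≤a = eventually-map
  (λ t h → ℤₚ.suc[i]≤j⇒i<j (subst (_ ≤_) (cancel _ _)
    (ℤₚ.+-monoˡ-≤ (evalᵥ R (+ t)) (subst (+ 1 ≤_) (evalWithLead-difference H₀ R a (+ t)) h))))
  (evalWithLead-eventually-≥1 (Vec.zipWith _-_ H₀ R) a 1≤a)
  where
  cancel : ∀ h r → h - r + r ≡ h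
  cancel = solve-∀

evalℤ-eventual-sign : ∀ P → (∀ t → evalℤ P (+ t) ≡ + 0)
                            ⊎ Eventually (λ t → + 1 ≤ evalℤ P (+ t))
                            ⊎ Eventually (λ t → evalℤ P (+ t) ≤ - + 1)
evalℤ-eventual-sign []      = inj₁ λ t → refl
evalℤ-eventual-sign (c ∷ P) with evalℤ-eventual-sign P
... | inj₂ (inj₁ pos) = inj₂ (inj₁ (horner-eventually-≥1 c (λ t → evalℤ P (+ t)) pos))
... | inj₂ (inj₂ neg) = inj₂ (inj₂ (horner-eventually-≤-1 c (λ t → evalℤ P (+ t)) neg))
... | inj₁ P≡0 = constant c (λ t → trans (cong (λ e → c + + t * e) (P≡0 t)) (drop c (+ t)))
  where
  drop : ∀ c t → c + t * + 0 ≡ c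
  drop = solve-∀
  constant : ∀ c → (∀ t → evalℤ (c ∷ P) (+ t) ≡ c) →
             (∀ t → evalℤ (c ∷ P) (+ t) ≡ + 0)
             ⊎ Eventually (λ t → + 1 ≤ evalℤ (c ∷ P) (+ t))
             ⊎ Eventually (λ t → evalℤ (c ∷ P) (+ t) ≤ - + 1)
  constant (+ zero)  ≡c = inj₁ ≡c
  constant +[1+ n ]  ≡c = inj₂ (inj₁ (always λ t → subst (+ 1 ≤_) (sym (≡c t)) (+≤+ (ℕ.s≤s ℕ.z≤n))))
  constant -[1+ n ]  ≡c = inj₂ (inj₂ (always λ t → subst (_≤ - + 1) (sym (≡c t)) (-≤- ℕ.z≤n)))

-- Mild EQP functions

mildEQP-resp-eventually : ∀ {g g' : ℕ → ℤ} → MildEQP g → Eventually (λ t → g' t ≡ g t) → MildEQP g'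
mildEQP-resp-eventually (M , f , same-degLead , T , g≡f) (T' , g'≡g) =
  M , f , same-degLead , T ⊔ T' , λ t T⊔T'≤t →
    trans (cong toℚ (g'≡g t (ℕₚ.m⊔n≤o⇒n≤o T T' T⊔T'≤t))) (g≡f t (ℕₚ.m⊔n≤o⇒m≤o T T' T⊔T'≤t))

scaleℚ : ℚ → Polyℤ → Polyℚ
scaleℚ w = List.map (λ c → toℚ c ℚ.* w)

evalℚ-scaleℚ : ∀ w P x → evalℚ (scaleℚ w P) (toℚ x) ≡ toℚ (evalℤ P x) ℚ.* w
evalℚ-scaleℚ w []      x = sym (ℚₚ.*-zeroˡ w)
evalℚ-scaleℚ w (c ∷ P) x = begin
  toℚ c ℚ.* w ℚ.+ toℚ x ℚ.* evalℚ (scaleℚ w P) (toℚ x)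
    ≡⟨ cong (λ e → toℚ c ℚ.* w ℚ.+ toℚ x ℚ.* e) (evalℚ-scaleℚ w P x) ⟩
  toℚ c ℚ.* w ℚ.+ toℚ x ℚ.* (toℚ e ℚ.* w)
    ≡⟨ cong (toℚ c ℚ.* w ℚ.+_) (sym (ℚₚ.*-assoc (toℚ x) (toℚ e) w)) ⟩
  toℚ c ℚ.* w ℚ.+ toℚ x ℚ.* toℚ e ℚ.* w
    ≡⟨ sym (ℚₚ.*-distribʳ-+ w (toℚ c) (toℚ x ℚ.* toℚ e)) ⟩
  (toℚ c ℚ.+ toℚ x ℚ.* toℚ e) ℚ.* w
    ≡⟨ cong (ℚ._* w) (sym (trans (toℚ-homo-+ c (x * e)) (cong (toℚ c ℚ.+_) (toℚ-homo-* x e)))) ⟩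
  toℚ (c + x * e) ℚ.* w
    ∎
  where
  open ≡-Reasoning
  e = evalℤ P x

degLead-∷-cong : ∀ {x y : ℚ} ys → (degLead ys ≡ nothing → x ≡ y) → degLead (x ∷ ys) ≡ degLead (y ∷ ys)
degLead-∷-cong ys x≡y with degLead ys
... | just _  = refl
... | nothing rewrite x≡y refl = refl

degLead≡nothing⇒zeros : ∀ ys → degLead ys ≡ nothing → All (_≡ 0ℚ) ys
degLead≡nothing⇒zeros []       _ = []
degLead≡nothing⇒zeros (y ∷ ys) eq with degLead ys in eq′
degLead≡nothing⇒zeros (y ∷ ys) () | just _
degLead≡nothing⇒zeros (y ∷ ys) eq | nothing with y ℚₚ.≟ 0ℚ
degLead≡nothing⇒zeros (y ∷ ys) eq | nothing | yes y≡0 = y≡0 ∷ degLead≡nothing⇒zeros ys eq′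
degLead≡nothing⇒zeros (y ∷ ys) () | nothing | no _

-- Changing the constant term can only change degLead when P is constant.
degLead-subConst : ∀ (φ : ℤ → ℚ) → (∀ c → φ c ≡ 0ℚ → c ≡ + 0) → ∀ P {v v'} →
                   ((∀ x y → evalℤ P x ≡ evalℤ P y) → v ≡ v') →
                   degLead (List.map φ (subConst v P)) ≡ degLead (List.map φ (subConst v' P))
degLead-subConst φ φ-zero []      v≡v' = cong (λ v → degLead (φ (- v) ∷ [])) (v≡v' λ _ _ → refl)
degLead-subConst φ φ-zero (c ∷ P) v≡v' = degLead-∷-cong (List.map φ P) λ φP≡0 →
  let P≡0 = All.map (λ {c} → φ-zero c) (Allₚ.map⁻ (degLead≡nothing⇒zeros (List.map φ P) φP≡0))
  in cong (λ v → φ (c - v)) (v≡v' λ x y → trans (evalℤ-∷-zeros c P≡0 x) (sym (evalℤ-∷-zeros c P≡0 y)))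

quotient-mildEQP : ∀ P l → MildEQP (λ t → evalℤ P (+ t) /ℕ suc l)
quotient-mildEQP P l = l , f , same-degLead , 0 , λ t _ → agrees t
  where
  L = suc l
  w = + 1 / L
  residue : ℕ → ℕ
  residue i = evalℤ P (+ i) %ℕ L
  f : Fin L → Polyℚ
  f i = scaleℚ w (subConst (+ residue (toℕ i)) P)
  same-degLead : ∀ i j → degLead (f i) ≡ degLead (f j)
  same-degLead i j = degLead-subConst (λ c → toℚ c ℚ.* w) (λ c → toℚ-*-1/suc≡0 c l) P
    (λ constant → cong (λ e → + (e %ℕ L)) (constant (+ toℕ i) (+ toℕ j)))
  evalℤ-residue≡ : ∀ t → evalℤ P (+ t) - + residue (t ℕ.% L) ≡ (evalℤ P (+ t) /ℕ L) * + L
  evalℤ-residue≡ t = begin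
    evalℤ P (+ t) - + residue r                       ≡⟨ cong (_- + residue r) P[t]≡ ⟩
    + residue r + (Pr /ℕ L + j) * + L - + residue r   ≡⟨ cancel (+ residue r) ((Pr /ℕ L + j) * + L) ⟩
    (Pr /ℕ L + j) * + L                               ≡⟨ cong (_* + L) (sym P[t]/L≡) ⟩
    (evalℤ P (+ t) /ℕ L) * + L                        ∎
    where
    open ≡-Reasoning
    r = t ℕ.% L
    q = t ℕ./ L
    Pr = evalℤ P (+ r)
    t≡ : + t ≡ + r + + q * + L
    t≡ = trans (cong +_ (ℕD.m≡m%n+[m/n]*n t L)) (cong (_+_ (+ r)) (ℤₚ.pos-* q L))
    shift = evalℤ-+-multiple P (+ r) (+ q) (+ L)
    j = proj₁ shift
    collect : ∀ v p j L → v + p * L + j * L ≡ v + (p + j) * L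
    collect = solve-∀
    cancel : ∀ v y → v + y - v ≡ y
    cancel = solve-∀
    P[t]≡ : evalℤ P (+ t) ≡ + residue r + (Pr /ℕ L + j) * + L
    P[t]≡ = begin
      evalℤ P (+ t)                       ≡⟨ cong (evalℤ P) t≡ ⟩
      evalℤ P (+ r + + q * + L)           ≡⟨ proj₂ shift ⟩
      Pr + j * + L                        ≡⟨ cong (_+ j * + L) (ℤD.a≡a%ℕn+[a/ℕn]*n Pr L) ⟩
      + residue r + Pr /ℕ L * + L + j * + L ≡⟨ collect (+ residue r) (Pr /ℕ L) j (+ L) ⟩
      + residue r + (Pr /ℕ L + j) * + L   ∎
    P[t]/L≡ : evalℤ P (+ t) /ℕ L ≡ Pr /ℕ L + j
    P[t]/L≡ = /ℕ-unique (ℤD.n%ℕd<d Pr L) P[t]≡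
  agrees : ∀ t → toℚ (evalℤ P (+ t) /ℕ L) ≡ evalℚ (f (t ℕD.mod L)) (toℚ (+ t))
  agrees t = sym (begin
    evalℚ (f (t ℕD.mod L)) (toℚ (+ t))        ≡⟨ evalℚ-scaleℚ w (subConst (+ residue i) P) (+ t) ⟩
    toℚ (evalℤ (subConst (+ residue i) P) (+ t)) ℚ.* w
      ≡⟨ cong (λ e → toℚ e ℚ.* w) (evalℤ-subConst (+ residue i) P (+ t)) ⟩
    toℚ (Pt - + residue i) ℚ.* w
      ≡⟨ cong (λ i → toℚ (Pt - + residue i) ℚ.* w) (Finₚ.toℕ-fromℕ< (ℕD.m%n<n t L)) ⟩
    toℚ (Pt - + residue (t ℕ.% L)) ℚ.* w      ≡⟨ cong (λ e → toℚ e ℚ.* w) (evalℤ-residue≡ t) ⟩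
    toℚ ((Pt /ℕ L) * + L) ℚ.* w               ≡⟨ toℚ-*-cancel (Pt /ℕ L) l ⟩
    toℚ (Pt /ℕ L)                             ∎)
    where
    open ≡-Reasoning
    Pt = evalℤ P (+ t)
    i = toℕ (t ℕD.mod L)

-- Floor of f/h as a mild EQP

module _ (F : Polyℤ) {d} (H₀ : Vec ℤ d) (n : ℕ) where
  private
    open PseudoDivision (pseudoDivide H₀ +[1+ n ] F)
    l = proj₁ (^-positive n exponent)
    Q H R : ℕ → ℤ
    Q t = evalℤ quotient (+ t)
    H t = evalWithLead H₀ +[1+ n ] (+ t)
    R t = evalᵥ remainder (+ t)
    division : ∀ t → + suc l * evalℤ F (+ t) ≡ Q t * H t + R t
    division t = trans (cong (_* evalℤ F (+ t)) (sym (proj₂ (^-positive n exponent)))) (identity (+ t))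
    R<H : Eventually (λ t → R t < H t)
    R<H = evalᵥ-eventually-< H₀ remainder +[1+ n ] (+≤+ (ℕ.s≤s ℕ.z≤n))
    -R<H : Eventually (λ t → - R t < H t)
    -R<H = eventually-map
      (λ t → subst (_< H t) (trans (evalᵥ-scale (- + 1) remainder (+ t)) (ℤₚ.-1*i≡-i (R t))))
      (evalᵥ-eventually-< H₀ (scaleᵥ (- + 1) remainder) +[1+ n ] (+≤+ (ℕ.s≤s ℕ.z≤n)))
    nonnegative : Eventually (λ t → + 0 ≤ R t) → MildEQP (λ t → ⌊ divℚ (evalℤ F (+ t)) (H t) ⌋)
    nonnegative R≥0 = mildEQP-resp-eventually (quotient-mildEQP quotient l) (eventually-map
      (λ t (0≤Rt , Rt<Ht) → ⌊divℚ⌋≡/ℕ l {Q = Q t} (division t) 0≤Rt Rt<Ht)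
      (eventually-× R≥0 R<H))
    negative : Eventually (λ t → R t < + 0) → MildEQP (λ t → ⌊ divℚ (evalℤ F (+ t)) (H t) ⌋)
    negative R<0 = mildEQP-resp-eventually (quotient-mildEQP (subConst (+ 1) quotient) l) (eventually-map
      (λ t (Rt<0 , -Rt<Ht) → trans (⌊divℚ⌋≡[Q-1]/ℕ l {Q = Q t} (division t) Rt<0 -Rt<Ht)
                                   (cong (_/ℕ suc l) (sym (evalℤ-subConst (+ 1) quotient (+ t)))))
      (eventually-× R<0 -R<H))

  floor-quotient-pos-lead : MildEQP (λ t → ⌊ divℚ (evalℤ F (+ t)) (evalWithLead H₀ +[1+ n ] (+ t)) ⌋)
  floor-quotient-pos-lead with evalℤ-eventual-sign (Vec.toList remainder)
  ... | inj₁ R≡0         = nonnegative (always λ t → ℤₚ.≤-reflexive (sym (R≡0 t)))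
  ... | inj₂ (inj₁ R≥1)  = nonnegative (eventually-map (λ t → ℤₚ.≤-trans (+≤+ ℕ.z≤n)) R≥1)
  ... | inj₂ (inj₂ R≤-1) = negative (eventually-map (λ t Rt≤-1 → ℤₚ.≤-<-trans Rt≤-1 ℤ.-<+) R≤-1)

floor-quotient-lead : ∀ F {d} (H₀ : Vec ℤ d) a → ¬ a ≡ + 0 →
                      MildEQP (λ t → ⌊ divℚ (evalℤ F (+ t)) (evalWithLead H₀ a (+ t)) ⌋)
floor-quotient-lead F H₀ (+ zero) a≢0 = ⊥-elim (a≢0 refl)
floor-quotient-lead F H₀ +[1+ n ] _   = floor-quotient-pos-lead F H₀ n
floor-quotient-lead F H₀ -[1+ n ] _   =
  mildEQP-resp-eventually (floor-quotient-pos-lead (scale (- + 1) F) (scaleᵥ (- + 1) H₀) n)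
    (always λ t → cong ⌊_⌋ (trans (divℚ-neg (evalℤ F (+ t)) (evalWithLead H₀ -[1+ n ] (+ t)))
                                  (cong₂ divℚ (negate-F (+ t)) (negate-H (+ t)))))
  where
  negate-F : ∀ x → - evalℤ F x ≡ evalℤ (scale (- + 1) F) x
  negate-F x = sym (trans (evalℤ-scale (- + 1) F x) (ℤₚ.-1*i≡-i (evalℤ F x)))
  negate-H : ∀ x → - evalWithLead H₀ -[1+ n ] x ≡ evalWithLead (scaleᵥ (- + 1) H₀) +[1+ n ] x
  negate-H x = sym (trans (cong (λ a → evalWithLead (scaleᵥ (- + 1) H₀) a x) (sym (ℤₚ.-1*i≡-i -[1+ n ])))
                          (trans (evalWithLead-scale (- + 1) H₀ -[1+ n ] x) (ℤₚ.-1*i≡-i _)))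

floor-quotient-mildEQP : ∀ f h → ¬ IsZeroPolyℤ h →
                         MildEQP (λ t → ⌊ divℚ (evalℤ f (+ t)) (evalℤ h (+ t)) ⌋)
floor-quotient-mildEQP f h h≢0 with leadingForm h h≢0
... | d , H₀ , a , a≢0 , h≡ = mildEQP-resp-eventually (floor-quotient-lead f H₀ a a≢0)
  (always λ t → cong (λ e → ⌊ divℚ (evalℤ f (+ t)) e ⌋) (h≡ (+ t)))

round-quotient-mildEQP : ∀ f h → ¬ IsZeroPolyℤ h →
                         MildEQP (λ t → ⌊ divℚ (evalℤ f (+ t)) (evalℤ h (+ t)) ⌉)
round-quotient-mildEQP f h h≢0 = mildEQP-resp-eventually
  (floor-quotient-mildEQP (scale (+ 2) f +ₚ h) (scale (+ 2) h) (scale-nonzero (+ 2) h h≢0))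
  (always λ t → trans (round-as-floor (evalℤ f (+ t)) (evalℤ h (+ t)))
                      (cong₂ (λ u v → ⌊ divℚ u v ⌋) (sym (numerator (+ t))) (sym (evalℤ-scale (+ 2) h (+ t)))))
  where
  numerator : ∀ x → evalℤ (scale (+ 2) f +ₚ h) x ≡ + 2 * evalℤ f x + evalℤ h x
  numerator x = trans (evalℤ-+ₚ (scale (+ 2) f) h x) (cong (_+ evalℤ h x) (evalℤ-scale (+ 2) f x))

lemma2p9 : (f h : Polyℤ) → ¬ IsZeroPolyℤ h →
    MildEQP (λ t → ⌊ divℚ (evalℤ f (+ t)) (evalℤ h (+ t)) ⌋)
      × MildEQP (λ t → ⌊ divℚ (evalℤ f (+ t)) (evalℤ h (+ t)) ⌉)
lemma2p9 f h h≢0 = floor-quotient-mildEQP f h h≢0 , round-quotient-mildEQP f h h≢0
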